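{- Let $k\ge 1$, $a\in\mathbb{C}$ and $\mathbf{x}=(x_1,\dots,x_k)\in\mathbb{C}^k$. The power series $$E_k(t,\mathbf{x},a)=\sum_{n=0}^{\infty} f_n(\mathbf{x},a)\frac{t^n}{n!}$$ is a solution of the differential equation $u^{(k)}=ae^{u}$ (derivatives with respect to $t$), i.e. $\frac{\partial^k}{\partial t^k}E_k(t,\mathbf{x},a)=a\,e^{E_k(t,\mathbf{x},a)}$ as power series in $t$. Moreover $E_k$ satisfies the initial conditions $E_k(0)=x_1$, $E_k'(0)=x_2,\dots,E_k^{(k-1)}(0)=x_k$.
   Context: The complete exponential Bell polynomials $B_n(y_1,\dots,y_n)$ are defined by $\exp\left(\sum_{m\ge1} y_m t^m/m!\right)=\sum_{n\ge0}B_n(y_1,\dots,y_n)t^n/n!$, so $B_0=1$. For $\mathbf{x}=(x_1,\dots,x_k)$ the complete exponential autonomous functions of order $k$ are defined recursively by $f_j(\mathbf{x},a)=x_{j+1}$ for $0\le j\le k-1$, $f_k(\mathbf{x},a)=ae^{x_1}$, and $f_{n+k}(\mathbf{x},a)=ae^{x_1}B_n(f_1(\mathbf{x},a),\dots,f_n(\mathbf{x},a))$ for $n\ge1$. Here $e^{E_k}$ is understood as $e^{x_1}\exp(E_k-x_1)$. -}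

module Defs where

open import Level using (Level)
open import Data.Nat using (ℕ; zero; suc; _∸_; _<_; _<?_; _!)
open import Data.Fin using (Fin; fromℕ<; fromℕ)
open import Data.Vec using (Vec; []; _∷ʳ_; lookup)
open import Relation.Nullary using (yes; no)
open import Algebra.Bundles using (CommutativeRing)

-- Formal power series (ordinary coefficients) over a commutative ring R in
-- which every positive integer n+1 has the inverse `inv n` (a Q-algebra).
module Series {c ℓ : Level} (R : CommutativeRing c ℓ)
              (inv : ℕ → CommutativeRing.Carrier R) where
  open CommutativeRing R hiding (zero)

  Ser : Set c
  Ser = ℕ → Carrier

  ι : ℕ → Carrier
  ι zero = 0#
  ι (suc n) = 1# + ι n

  invFact : ℕ → Carrier
  invFact zero = 1#
  invFact (suc m) = invFact m * inv m

  Σ< : ℕ → (ℕ → Carrier) → Carrier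
  Σ< zero g = 0#
  Σ< (suc n) g = Σ< n g + g n

  oneS : Ser
  oneS zero = 1#
  oneS (suc n) = 0#

  _⊛_ : Ser → Ser → Ser
  (u ⊛ v) n = Σ< (suc n) (λ i → u i * v (n ∸ i))

  powS : Ser → ℕ → Ser
  powS u zero = oneS
  powS u (suc m) = u ⊛ powS u m

  -- exp(g) = Σ_m g^m / m!  for a series g with zero constant term
  -- (coefficient n only receives contributions from m ≤ n)
  expS : Ser → Ser
  expS g n = Σ< (suc n) (λ m → invFact m * powS g m n)

  D : Ser → Ser
  D u n = ι (suc n) * u (suc n)

  iterD : ℕ → Ser → Ser
  iterD zero u = u
  iterD (suc j) u = D (iterD j u)

  subConst : Ser → Carrier → Ser
  subConst u x zero = u zero - x
  subConst u x (suc n) = u (suc n)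

  -- complete exponential Bell polynomial:
  -- B_n(y_1..y_n) = n! [t^n] exp(Σ_{m≥1} y_m t^m / m!)   (only y_1..y_n are used)
  Bell : ℕ → (ℕ → Carrier) → Carrier
  Bell n y = ι (n !) * expS G n
    where
      G : Ser
      G zero = 0#
      G (suc m) = y (suc m) * invFact (suc m)

  -- complete exponential autonomous functions f_n(x,a) of order k,
  -- with `ex1` standing for e^{x_1}
  module Auto (k : ℕ) (x : Fin k → Carrier) (a ex1 : Carrier) where
    look : {N : ℕ} → Vec Carrier N → ℕ → Carrier
    look {N} v m with m <? N
    ... | yes m<N = lookup v (fromℕ< m<N)
    ... | no _ = 0#

    next : (N : ℕ) → Vec Carrier N → Carrier
    next N prev with N <? k
    ... | yes N<k = x (fromℕ< N<k)
    ... | no _ = a * ex1 * Bell (N ∸ k) (look prev)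

    table : (N : ℕ) → Vec Carrier N
    table zero = []
    table (suc N) = table N ∷ʳ next N (table N)

    f : ℕ → Carrier
    f n = lookup (table (suc n)) (fromℕ n)

    E : Ser
    E n = f n * invFact n

-- Differentiating E = Σ f_n tⁿ/n! shifts coefficients: the n-th coefficient of
-- E⁽ᵏ⁾ is f_{k+n}/n!.  By the defining recurrence f_{k+n} = a e^{x₁} B_n(f_1,…,f_n),
-- and B_n(y)/n! is by definition the n-th coefficient of exp(Σ_{m≥1} y_m t^m/m!).
-- With y = f this exponent is exactly E − x₁, so E⁽ᵏ⁾ = a e^{x₁} exp(E − x₁) = a e^E.
-- The initial conditions are the first k cases of the recurrence.
module Submission where

open import Defs
open import Level using (Level)
open import Data.Nat as ℕ using (ℕ; zero; suc; _≤_; _<_; _<?_; _!; s≤s)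
open import Data.Nat.Properties as ℕₚ
  using (≤-refl; ≤-trans; m<n⇒m<1+n; m<1+n⇒m≤n; m<1+n⇒m<n∨m≡n; m∸n≤m; +-suc; +-monoˡ-≤; m+n≮m; m+n∸m≡n)
open import Data.Fin using (Fin; fromℕ<; fromℕ)
open import Data.Fin.Properties using (fromℕ-def)
open import Data.Vec using (Vec; []; _∷_; _∷ʳ_; lookup)
open import Data.Product using (_×_; _,_)
open import Data.Sum using (inj₁; inj₂)
open import Data.Empty using (⊥-elim)
open import Relation.Nullary using (yes; no)
open import Relation.Binary.PropositionalEquality as ≡ using (_≡_)
import Relation.Binary.Reasoning.Setoid as SetoidReasoning
open import Algebra.Bundles using (CommutativeRing)
import Algebra.Properties.CommutativeSemigroup as CommSemigroupProperties
import Algebra.Properties.Semiring.Mult as SemiringMult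

lookup-∷ʳ-fromℕ : ∀ {a} {A : Set a} {n} (xs : Vec A n) y → lookup (xs ∷ʳ y) (fromℕ n) ≡ y
lookup-∷ʳ-fromℕ [] y = ≡.refl
lookup-∷ʳ-fromℕ (_ ∷ xs) y = lookup-∷ʳ-fromℕ xs y

lookup-∷ʳ-fromℕ< : ∀ {a} {A : Set a} {n} (xs : Vec A n) y m (m<n : m < n) .(m<1+n : m < suc n) →
                   lookup (xs ∷ʳ y) (fromℕ< m<1+n) ≡ lookup xs (fromℕ< m<n)
lookup-∷ʳ-fromℕ< (_ ∷ xs) y zero _ _ = ≡.refl
lookup-∷ʳ-fromℕ< (_ ∷ xs) y (suc m) (s≤s m<n) _ = lookup-∷ʳ-fromℕ< xs y m m<n _

module SeriesProperties {c ℓ : Level} (R : CommutativeRing c ℓ)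
                        (inv : ℕ → CommutativeRing.Carrier R) where
  open CommutativeRing R hiding (zero)
  open Series R inv
  open SetoidReasoning setoid
  open CommSemigroupProperties *-commutativeSemigroup using (x∙yz≈y∙xz)
  open SemiringMult semiring using (×1-homo-*) renaming (_×_ to _×′_)

  AgreeUpTo : ℕ → Ser → Ser → Set ℓ
  AgreeUpTo n u v = ∀ i → i ≤ n → u i ≈ v i

  Σ<-cong : ∀ m {g h} → (∀ i → i < m → g i ≈ h i) → Σ< m g ≈ Σ< m h
  Σ<-cong zero    g≈h = refl
  Σ<-cong (suc m) g≈h = +-cong (Σ<-cong m λ i i<m → g≈h i (m<n⇒m<1+n i<m)) (g≈h m ≤-refl)

  ⊛-agree : ∀ {n u v w z} → AgreeUpTo n u v → AgreeUpTo n w z → AgreeUpTo n (u ⊛ w) (v ⊛ z)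
  ⊛-agree u≈v w≈z i i≤n = Σ<-cong (suc i) λ j j<1+i →
    *-cong (u≈v j (≤-trans (m<1+n⇒m≤n j<1+i) i≤n)) (w≈z _ (≤-trans (m∸n≤m i j) i≤n))

  powS-agree : ∀ {n u v} → AgreeUpTo n u v → ∀ m → AgreeUpTo n (powS u m) (powS v m)
  powS-agree u≈v zero    i i≤n = refl
  powS-agree u≈v (suc m) = ⊛-agree u≈v (powS-agree u≈v m)

  expS-agree : ∀ {n u v} → AgreeUpTo n u v → expS u n ≈ expS v n
  expS-agree {n} u≈v = Σ<-cong (suc n) λ m _ → *-congˡ (powS-agree u≈v m n ≤-refl)

  egf₊ : (ℕ → Carrier) → Ser
  egf₊ y zero    = 0#
  egf₊ y (suc m) = y (suc m) * invFact (suc m)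

  Bell-cong : ∀ n {y z} → AgreeUpTo n y z → Bell n y ≈ Bell n z
  Bell-cong n y≈z = *-congˡ (expS-agree {n} λ where
    zero    _     → refl
    (suc m) 1+m≤n → *-congʳ (y≈z (suc m) 1+m≤n))

  egf₊≈subConst : ∀ {F x} → F 0 ≈ x → ∀ i → egf₊ F i ≈ subConst (λ m → F m * invFact m) x i
  egf₊≈subConst {F} {x} F₀≈x zero = sym (begin
    F 0 * 1# - x ≈⟨ +-congʳ (trans (*-identityʳ (F 0)) F₀≈x) ⟩
    x - x        ≈⟨ -‿inverseʳ x ⟩
    0#           ∎)
  egf₊≈subConst _ (suc m) = refl

  ι≡×1 : ∀ n → ι n ≡ n ×′ 1#
  ι≡×1 zero    = ≡.refl
  ι≡×1 (suc n) = ≡.cong (1# +_) (ι≡×1 n)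

  ι-* : ∀ m n → ι (m ℕ.* n) ≈ ι m * ι n
  ι-* m n rewrite ι≡×1 (m ℕ.* n) | ι≡×1 m | ι≡×1 n = ×1-homo-* m n

  module _ (ι-suc*inv≈1 : ∀ n → ι (suc n) * inv n ≈ 1#) where

    ι-suc*invFact-suc : ∀ n y → ι (suc n) * (y * invFact (suc n)) ≈ y * invFact n
    ι-suc*invFact-suc n y = begin
      ι (suc n) * (y * (invFact n * inv n)) ≈⟨ x∙yz≈y∙xz _ _ _ ⟩
      y * (ι (suc n) * (invFact n * inv n)) ≈⟨ *-congˡ (x∙yz≈y∙xz _ _ _) ⟩
      y * (invFact n * (ι (suc n) * inv n)) ≈⟨ *-congˡ (*-congˡ (ι-suc*inv≈1 n)) ⟩
      y * (invFact n * 1#)                  ≈⟨ *-congˡ (*-identityʳ (invFact n)) ⟩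
      y * invFact n                         ∎

    ι-!*invFact : ∀ n → ι (n !) * invFact n ≈ 1#
    ι-!*invFact zero    = trans (*-identityʳ _) (+-identityʳ 1#)
    ι-!*invFact (suc n) = begin
      ι (suc n ℕ.* n !) * invFact (suc n)     ≈⟨ *-congʳ (ι-* (suc n) (n !)) ⟩
      (ι (suc n) * ι (n !)) * invFact (suc n) ≈⟨ *-assoc _ _ _ ⟩
      ι (suc n) * (ι (n !) * invFact (suc n)) ≈⟨ ι-suc*invFact-suc n (ι (n !)) ⟩
      ι (n !) * invFact n                     ≈⟨ ι-!*invFact n ⟩
      1#                                      ∎

    iterD-egf : ∀ (F : ℕ → Carrier) j n → iterD j (λ m → F m * invFact m) n ≈ F (j ℕ.+ n) * invFact n
    iterD-egf F zero    n = refl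
    iterD-egf F (suc j) n = begin
      ι (suc n) * iterD j (λ m → F m * invFact m) (suc n) ≈⟨ *-congˡ (iterD-egf F j (suc n)) ⟩
      ι (suc n) * (F (j ℕ.+ suc n) * invFact (suc n))     ≈⟨ ι-suc*invFact-suc n _ ⟩
      F (j ℕ.+ suc n) * invFact n                         ≈⟨ *-congʳ (reflexive (≡.cong F (+-suc j n))) ⟩
      F (suc j ℕ.+ n) * invFact n                         ∎

    Bell*invFact : ∀ n y → Bell n y * invFact n ≈ expS (egf₊ y) n
    Bell*invFact n y = begin
      (ι (n !) * expS _ n) * invFact n ≈⟨ *-congʳ (*-comm _ _) ⟩
      (expS _ n * ι (n !)) * invFact n ≈⟨ *-assoc _ _ _ ⟩
      expS _ n * (ι (n !) * invFact n) ≈⟨ *-congˡ (ι-!*invFact n) ⟩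
      expS _ n * 1#                    ≈⟨ *-identityʳ _ ⟩
      expS _ n                         ≈⟨ expS-agree {n} (λ where
                                            zero    _ → refl
                                            (suc m) _ → refl) ⟩
      expS (egf₊ y) n                  ∎

module AutonomousProperties {c ℓ : Level} (R : CommutativeRing c ℓ)
                            (inv : ℕ → CommutativeRing.Carrier R)
                            (k : ℕ) (x : Fin k → CommutativeRing.Carrier R)
                            (a ex1 : CommutativeRing.Carrier R) where
  open CommutativeRing R hiding (zero)
  open Series R inv
  open SeriesProperties R inv using (Bell-cong)
  open Auto k x a ex1

  f-next : ∀ N → f N ≡ next N (table N)
  f-next N = lookup-∷ʳ-fromℕ (table N) _

  lookup-table : ∀ N m (m<N : m < N) → lookup (table N) (fromℕ< m<N) ≡ f m
  lookup-table (suc N) m m<1+N with m<1+n⇒m<n∨m≡n m<1+N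
  ... | inj₁ m<N    = ≡.trans (lookup-∷ʳ-fromℕ< (table N) _ m m<N m<1+N) (lookup-table N m m<N)
  ... | inj₂ ≡.refl = ≡.cong (lookup (table (suc m))) (≡.sym (fromℕ-def m))

  look-table : ∀ N m → m < N → look (table N) m ≡ f m
  look-table N m m<N with m <? N
  ... | yes m<N′ = lookup-table N m m<N′
  ... | no  m≮N  = ⊥-elim (m≮N m<N)

  next-initial : ∀ j (j<k : j < k) → next j (table j) ≡ x (fromℕ< j<k)
  next-initial j j<k with j <? k
  ... | yes _   = ≡.refl
  ... | no  j≮k = ⊥-elim (j≮k j<k)

  next-recurrence : ∀ n → next (k ℕ.+ n) (table (k ℕ.+ n)) ≡ a * ex1 * Bell n (look (table (k ℕ.+ n)))
  next-recurrence n with (k ℕ.+ n) <? k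
  ... | yes k+n<k = ⊥-elim (m+n≮m k n k+n<k)
  ... | no  _     = ≡.cong (λ i → a * ex1 * Bell i (look (table (k ℕ.+ n)))) (m+n∸m≡n k n)

  f-initial : ∀ j (j<k : j < k) → f j ≡ x (fromℕ< j<k)
  f-initial j j<k = ≡.trans (f-next j) (next-initial j j<k)

  f-recurrence : 1 ≤ k → ∀ n → f (k ℕ.+ n) ≈ a * ex1 * Bell n f
  f-recurrence k≥1 n = trans (reflexive (≡.trans (f-next (k ℕ.+ n)) (next-recurrence n)))
    (*-congˡ (Bell-cong n λ m m≤n →
      reflexive (look-table (k ℕ.+ n) m (≤-trans (s≤s m≤n) (+-monoˡ-≤ n k≥1)))))

mainTheorem1 : ∀ {c ℓ : Level} (R : CommutativeRing c ℓ)
  (inv : ℕ → CommutativeRing.Carrier R) →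
  (∀ n → CommutativeRing._≈_ R
           (CommutativeRing._*_ R (Series.ι R inv (suc n)) (inv n))
           (CommutativeRing.1# R)) →
  (exp : CommutativeRing.Carrier R → CommutativeRing.Carrier R) →
  (k : ℕ) (k≥1 : 1 ≤ k) (x : Fin k → CommutativeRing.Carrier R)
  (a : CommutativeRing.Carrier R) →
  let open CommutativeRing R
      open Series R inv
      x₁ = x (fromℕ< k≥1)
      Ek = Auto.E k x a (exp x₁)
  in (∀ n → iterD k Ek n ≈ (a * exp x₁) * expS (subConst Ek x₁) n)
     × (∀ j (j<k : j < k) → iterD j Ek 0 ≈ x (fromℕ< j<k))
mainTheorem1 R inv ι-suc*inv≈1 exp k k≥1 x a = E-ode , E-initial
  where
  x₁ = x (fromℕ< k≥1)
  open CommutativeRing R hiding (zero)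
  open Series R inv
  open SeriesProperties R inv
  open Auto k x a (exp x₁)
  open AutonomousProperties R inv k x a (exp x₁)
  open SetoidReasoning setoid

  E-ode : ∀ n → iterD k E n ≈ (a * exp x₁) * expS (subConst E x₁) n
  E-ode n = begin
    iterD k E n                         ≈⟨ iterD-egf ι-suc*inv≈1 f k n ⟩
    f (k ℕ.+ n) * invFact n             ≈⟨ *-congʳ (f-recurrence k≥1 n) ⟩
    (a * exp x₁ * Bell n f) * invFact n ≈⟨ *-assoc _ _ _ ⟩
    a * exp x₁ * (Bell n f * invFact n) ≈⟨ *-congˡ (Bell*invFact ι-suc*inv≈1 n f) ⟩
    a * exp x₁ * expS (egf₊ f) n        ≈⟨ *-congˡ (expS-agree {n} λ i _ →
                                             egf₊≈subConst (reflexive (f-initial 0 k≥1)) i) ⟩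
    a * exp x₁ * expS (subConst E x₁) n ∎

  E-initial : ∀ j (j<k : j < k) → iterD j E 0 ≈ x (fromℕ< j<k)
  E-initial j j<k = begin
    iterD j E 0      ≈⟨ iterD-egf ι-suc*inv≈1 f j 0 ⟩
    f (j ℕ.+ 0) * 1# ≈⟨ *-identityʳ _ ⟩
    f (j ℕ.+ 0)      ≈⟨ reflexive (≡.cong f (ℕₚ.+-identityʳ j)) ⟩
    f j              ≈⟨ reflexive (f-initial j j<k) ⟩
    x (fromℕ< j<k)   ∎
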